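{- Let $n$ be even, $d\in\mathbb Z$, $\mu=(\mu^\tau)_{\tau:F\to E}$ a dominant integral weight with $\mu^\tau_1\geq\cdots\geq\mu^\tau_{n-1}\geq|\mu^\tau_n|$ and $\mu_{\min}=\min_\tau|\mu^\tau_n|\geq1$, and assume $1-\mu_{\min}\leq-(n+d)\leq\mu_{\min}-1$. Let $w\in W^P$ be a balanced Kostant representative such that $\lambda:=w^{ -1}\cdot(de_0+\mu)$ is dominant integral for $G$. Put $w'=w_Pw$, $w^\vee=w_Mww_G$, $w^\vee{}'=w_Pw^\vee$, and $\lambda^\vee=-w_G\lambda$. Then (1) $w'\cdot\lambda=(-d-2n)e_0+{}^{\kappa_{2n}}\mu$; (2) $w^\vee\cdot\lambda^\vee=(-d-2n)e_0+\mu$; (3) $w^\vee{}'\cdot\lambda^\vee=de_0+{}^{\kappa_{2n}}\mu$.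
   Context: Notation as for $G_0=\mathrm{O}(2n+2)$ split over a totally real field $F$, $G=\mathrm{Res}_{F/\mathbb Q}G_0$: roots relative to the diagonal torus with characters $e_0,\dots,e_n$; simple roots $\alpha_0=e_0-e_1,\dots,\alpha_{n-1}=e_{n-1}-e_n$, $\alpha_n=e_{n-1}+e_n$; $\rho=\sum_{j=0}^n(n-j)e_j$; Weyl group = signed permutations of $\{e_0,\dots,e_n\}$ with an even number of sign changes; twisted action $w\cdot\lambda=w(\lambda+\rho)-\rho$; $W^{P_0}=\{w: w^{ -1}\alpha_i>0,\ 1\leq i\leq n\}$, balanced means length $n$. Over $E$ (finite Galois over $\mathbb Q$, $\mathrm{Hom}(F,E)=\mathrm{Hom}(F,\mathbb R)$), weights and Weyl group elements are tuples indexed by $\tau:F\to E$ and act componentwise; $W^P=\prod_\tau W^{P_0}$; dominance for $G$ means $\lambda^\tau_0\geq\cdots\geq\lambda^\tau_{n-1}\geq|\lambda^\tau_n|$ for all $\tau$. In every $\tau$-component: $w_P$ is $e_0\mapsto-e_0$, $e_n\mapsto-e_n$, $e_i\mapsto e_i$ ($1\leq i\leq n-1$); $w_G$ is $e_i\mapsto-e_i$ ($0\leq i\leq n-1$), $e_n\mapsto e_n$; $w_M$ is $e_0\mapsto e_0$, $e_i\mapsto-e_i$ ($1\leq i\leq n$). $de_0+\mu$ has $\tau$-component $de_0+\sum_{j=1}^n\mu^\tau_je_j$, and ${}^{\kappa_{2n}}\mu$ has $\tau$-component $(\mu^\tau_1,\dots,\mu^\tau_{n-1},-\mu^\tau_n)$.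 -}

module Defs where

open import Data.Bool using (Bool; true; false; if_then_else_; not; _xor_; T)
open import Data.Nat as ℕ using (ℕ; zero; suc; _≡ᵇ_)
open import Data.Integer as ℤ using (ℤ; +_; -_; _*_; _≤_; ∣_∣; 1ℤ; 0ℤ)
open import Data.Fin using (Fin; zero; suc; toℕ; fromℕ)
open import Data.Fin.Permutation using (Permutation′; _⟨$⟩ʳ_; _⟨$⟩ˡ_; _∘ₚ_; flip)
import Data.Fin.Permutation as Perm
open import Data.List using (List; []; _∷_; concatMap; allFin; map; length)
open import Data.Nat.ListAction using (sum)
open import Data.Bool.ListAction using (any; all)
open import Data.Nat.Divisibility using (_∣_)
open import Data.Product using (_×_)
open import Relation.Binary.PropositionalEquality using (_≡_)
open import Relation.Nullary.Decidable using (⌊_⌋)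

-- Vectors of integer coordinates w.r.t. e_0,…,e_n  (N = n+1 coordinates).
Vecℤ : ℕ → Set
Vecℤ N = Fin N → ℤ

_+ᵥ_ : ∀ {N} → Vecℤ N → Vecℤ N → Vecℤ N
(u +ᵥ v) i = u i ℤ.+ v i

_-ᵥ_ : ∀ {N} → Vecℤ N → Vecℤ N → Vecℤ N
(u -ᵥ v) i = u i ℤ.- v i

negᵥ : ∀ {N} → Vecℤ N → Vecℤ N
negᵥ v i = - v i

ρ : (n : ℕ) → Vecℤ (suc n)
ρ n j = + (n ℕ.∸ toℕ j)

-- Signed permutations of {e_0,…,e_{N-1}}:  w(e_i) = (-1)^{neg i} e_{perm i}.
record SPerm (N : ℕ) : Set where
  constructor sperm
  field
    perm : Permutation′ N
    neg  : Fin N → Bool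
open SPerm public

signChanges : ∀ {N} → SPerm N → ℕ
signChanges {N} w = sum (map (λ i → if neg w i then 1 else 0) (allFin N))

-- Weyl group of D_N: signed permutations with an even number of sign changes
IsWeyl : ∀ {N} → SPerm N → Set
IsWeyl w = 2 ∣ signChanges w

sgn : Bool → ℤ
sgn true  = - 1ℤ
sgn false = 1ℤ

act : ∀ {N} → SPerm N → Vecℤ N → Vecℤ N
act w λ' j = sgn (neg w i) * λ' i
  where i = perm w ⟨$⟩ˡ j

-- composition (w₁ ∘ʷ w₂)(v) = w₁(w₂(v))
_∘ʷ_ : ∀ {N} → SPerm N → SPerm N → SPerm N
w₁ ∘ʷ w₂ = sperm (perm w₂ ∘ₚ perm w₁) (λ i → neg w₂ i xor neg w₁ (perm w₂ ⟨$⟩ʳ i))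

invʷ : ∀ {N} → SPerm N → SPerm N
invʷ w = sperm (flip (perm w)) (λ j → neg w (perm w ⟨$⟩ˡ j))

dot : ∀ {n} → SPerm (suc n) → Vecℤ (suc n) → Vecℤ (suc n)
dot {n} w λ' = act w (λ' +ᵥ ρ n) -ᵥ ρ n

e : ∀ {N} → Fin N → Vecℤ N
e i j = if toℕ i ≡ᵇ toℕ j then 1ℤ else 0ℤ

posRoots : (N : ℕ) → List (Vecℤ N)
posRoots N = concatMap (λ i → concatMap (λ j →
    if ℕ._<ᵇ_ (toℕ i) (toℕ j) then (e i -ᵥ e j) ∷ (e i +ᵥ e j) ∷ [] else [])
  (allFin N)) (allFin N)

eqᵥ : ∀ {N} → Vecℤ N → Vecℤ N → Bool
eqᵥ {N} u v = all (λ i → ⌊ u i ℤ.≟ v i ⌋) (allFin N)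

isPosRoot : ∀ {N} → Vecℤ N → Bool
isPosRoot {N} v = any (eqᵥ v) (posRoots N)

lengthʷ : ∀ {N} → SPerm N → ℕ
lengthʷ {N} w = sum (map (λ β → if isPosRoot (act w β) then 0 else 1) (posRoots N))

-- simple roots α_k (k = toℕ of the index):
-- α_k = e_k - e_{k+1} for k < n,  α_n = e_{n-1} + e_n
α : (n : ℕ) → Fin (suc n) → Vecℤ (suc n)
α n k j with ℕ._<ᵇ_ (toℕ k) n
... | true  = if toℕ j ≡ᵇ toℕ k then 1ℤ else (if toℕ j ≡ᵇ suc (toℕ k) then - 1ℤ else 0ℤ)
... | false = if toℕ j ≡ᵇ n then 1ℤ else (if suc (toℕ j) ≡ᵇ n then 1ℤ else 0ℤ)

InWP0 : (n : ℕ) → SPerm (suc n) → Set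
InWP0 n w = IsWeyl w × ((k : Fin (suc n)) → 1 ℕ.≤ toℕ k → T (isPosRoot (act (invʷ w) (α n k))))

Balanced : (n : ℕ) → SPerm (suc n) → Set
Balanced n w = lengthʷ w ≡ n

diagSP : ∀ {N} → (Fin N → Bool) → SPerm N
diagSP f = sperm Perm.id f

wP : (n : ℕ) → SPerm (suc n)
wP n = diagSP (λ i → (toℕ i ≡ᵇ 0) Data.Bool.∨ (toℕ i ≡ᵇ n))

wG : (n : ℕ) → SPerm (suc n)
wG n = diagSP (λ i → ℕ._<ᵇ_ (toℕ i) n)

wM : (n : ℕ) → SPerm (suc n)
wM n = diagSP (λ i → ℕ._<ᵇ_ 0 (toℕ i))

DominantG : (n : ℕ) → Vecℤ (suc n) → Set
DominantG n λ' =
  ((i j : Fin (suc n)) → toℕ i ℕ.≤ toℕ j → toℕ j ℕ.< n → λ' j ≤ λ' i)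
  × ((i : Fin (suc n)) → toℕ i ℕ.< n → + ∣ λ' (fromℕ n) ∣ ≤ λ' i)

-- d e_0 + μ, where μ : Fin n → ℤ has coordinates μ_1,…,μ_n (μ i = μ_{i+1})
_e₀+_ : ∀ {n} → ℤ → (Fin n → ℤ) → Vecℤ (suc n)
(d e₀+ μ) zero = d
(d e₀+ μ) (suc i) = μ i

lastμ : ∀ {n} → (Fin n → ℤ) → ℤ
lastμ {n} μ = (0ℤ e₀+ μ) (fromℕ n)

DominantM : (n : ℕ) → (Fin n → ℤ) → Set
DominantM n μ =
  ((i j : Fin (suc n)) → 1 ℕ.≤ toℕ i → toℕ i ℕ.≤ toℕ j → toℕ j ℕ.< n → (0ℤ e₀+ μ) j ≤ (0ℤ e₀+ μ) i)
  × ((i : Fin (suc n)) → 1 ℕ.≤ toℕ i → toℕ i ℕ.< n → + ∣ lastμ μ ∣ ≤ (0ℤ e₀+ μ) i)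

κ : ∀ {n} → (Fin n → ℤ) → (Fin n → ℤ)
κ {n} μ i = if suc (toℕ i) ≡ᵇ n then - μ i else μ i

minFin : ∀ {k} → (Fin (suc k) → ℤ) → ℤ
minFin {zero} f = f zero
minFin {suc k} f = f zero ℤ.⊓ minFin (λ i → f (suc i))

μmin : ∀ {k n} → (Fin (suc k) → Fin n → ℤ) → ℤ
μmin μ = minFin (λ τ → + ∣ lastμ (μ τ) ∣)

module Submission where

-- Proposition 5.5 is a formal computation with the twisted action
-- w · λ = w(λ + ρ) − ρ of signed permutations on integer weights.  The proof uses three general facts:
--   * the twisted action is an action:  (a b) · x = a · (b · x), and
--     w · (w⁻¹ · x) = x;
--   * the involution ι(x) = −x − 2ρ (the twisted action of −1) commutes
--     with every twisted action, and w_G · (−w_G x) = ι(x) because w_G ρ = −ρ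
--     (ρ has vanishing last coordinate);
--   * the diagonal elements act coordinatewise by signs, which yields
--     w_P · (d e₀ + μ) = (−d − 2n) e₀ + κμ  and  w_M · ι(d e₀ + μ) = (−d − 2n) e₀ + μ.
-- With λ = w⁻¹ · (d e₀ + μ) and λ^∨ = −w_G λ, we get w · (w_G · λ^∨) = ι(d e₀ + μ);
-- then (1) and (2) follow from the diagonal formulas, and (3) applies the
-- w_P formula to the result of (2), since −(−d − 2n) − 2n = d.

open import Defs
open import Data.Nat as ℕ using (ℕ; suc)
open import Data.Nat.Divisibility using (_∣_)
open import Data.Integer as ℤ using (ℤ; +_; -_; _≤_; 1ℤ)
open import Data.Fin using (Fin)
open import Data.Product using (_×_)
open import Relation.Binary.PropositionalEquality using (_≡_)

open import Data.Bool using (Bool; true; false; T; _xor_)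
open import Data.Unit using (tt)
open import Data.Fin using (zero; suc; toℕ)
open import Data.Fin.Permutation using (_⟨$⟩ˡ_)
import Data.Fin.Permutation as Perm
open import Data.Product using (_,_)
open import Relation.Binary.PropositionalEquality
  using (_≗_; refl; sym; trans; cong; subst; module ≡-Reasoning)
import Data.Nat.Properties as ℕP
import Data.Integer.Properties as ℤP
open import Data.Integer.Tactic.RingSolver using (solve-∀)

sgn-xor : ∀ a b → sgn (a xor b) ≡ sgn b ℤ.* sgn a
sgn-xor false false = refl
sgn-xor false true  = refl
sgn-xor true  false = refl
sgn-xor true  true  = refl

sgn-involutive : ∀ a (x : ℤ) → sgn a ℤ.* (sgn a ℤ.* x) ≡ x
sgn-involutive false x = trans (ℤP.*-identityˡ _) (ℤP.*-identityˡ x)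
sgn-involutive true  x = minus-minus x
  where
  minus-minus : ∀ (x : ℤ) → - 1ℤ ℤ.* (- 1ℤ ℤ.* x) ≡ x
  minus-minus = solve-∀

act-cong : ∀ {N} (w : SPerm N) {x y : Vecℤ N} → x ≗ y → act w x ≗ act w y
act-cong w x≗y j = cong (sgn (neg w (perm w ⟨$⟩ˡ j)) ℤ.*_) (x≗y (perm w ⟨$⟩ˡ j))

act-∘ : ∀ {N} (a b : SPerm N) (x : Vecℤ N) → act (a ∘ʷ b) x ≗ act a (act b x)
act-∘ a b x j
  rewrite Perm.inverseʳ (perm b) {perm a ⟨$⟩ˡ j}
        | sgn-xor (neg b (perm b ⟨$⟩ˡ (perm a ⟨$⟩ˡ j))) (neg a (perm a ⟨$⟩ˡ j))
  = ℤP.*-assoc (sgn (neg a (perm a ⟨$⟩ˡ j))) (sgn (neg b (perm b ⟨$⟩ˡ (perm a ⟨$⟩ˡ j)))) _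

act-invʳ : ∀ {N} (w : SPerm N) (x : Vecℤ N) → act w (act (invʷ w) x) ≗ x
act-invʳ w x j rewrite Perm.inverseʳ (perm w) {j} = sgn-involutive (neg w (perm w ⟨$⟩ˡ j)) (x j)

act-neg : ∀ {N} (w : SPerm N) (x : Vecℤ N) → act w (negᵥ x) ≗ negᵥ (act w x)
act-neg w x j = sign-neg (sgn (neg w (perm w ⟨$⟩ˡ j))) (x (perm w ⟨$⟩ˡ j))
  where
  sign-neg : ∀ (s y : ℤ) → s ℤ.* (- y) ≡ - (s ℤ.* y)
  sign-neg = solve-∀

dot-cong : ∀ {n} (w : SPerm (suc n)) {x y : Vecℤ (suc n)} → x ≗ y → dot w x ≗ dot w y
dot-cong {n} w x≗y j = cong (ℤ._- ρ n j) (act-cong w (λ i → cong (ℤ._+ ρ n i) (x≗y i)) j)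

act-untwist : ∀ {n} (w : SPerm (suc n)) (x : Vecℤ (suc n)) →
              act w ((x -ᵥ ρ n) +ᵥ ρ n) ≗ act w x
act-untwist {n} w x = act-cong w (λ i → minus-plus (x i) (ρ n i))
  where
  minus-plus : ∀ (a r : ℤ) → (a ℤ.- r) ℤ.+ r ≡ a
  minus-plus = solve-∀

dot-∘ : ∀ {n} (a b : SPerm (suc n)) (x : Vecℤ (suc n)) → dot (a ∘ʷ b) x ≗ dot a (dot b x)
dot-∘ {n} a b x j = cong (ℤ._- ρ n j) (begin
  act (a ∘ʷ b) (x +ᵥ ρ n) j                     ≡⟨ act-∘ a b (x +ᵥ ρ n) j ⟩
  act a (act b (x +ᵥ ρ n)) j                    ≡˘⟨ act-untwist a (act b (x +ᵥ ρ n)) j ⟩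
  act a (dot b x +ᵥ ρ n) j                      ∎)
  where open ≡-Reasoning

dot-invʳ : ∀ {n} (w : SPerm (suc n)) (x : Vecℤ (suc n)) → dot w (dot (invʷ w) x) ≗ x
dot-invʳ {n} w x j = begin
  act w (dot (invʷ w) x +ᵥ ρ n) j ℤ.- ρ n j     ≡⟨ cong (ℤ._- ρ n j) (act-untwist w (act (invʷ w) (x +ᵥ ρ n)) j) ⟩
  act w (act (invʷ w) (x +ᵥ ρ n)) j ℤ.- ρ n j   ≡⟨ cong (ℤ._- ρ n j) (act-invʳ w (x +ᵥ ρ n) j) ⟩
  (x j ℤ.+ ρ n j) ℤ.- ρ n j                     ≡⟨ plus-minus (x j) (ρ n j) ⟩
  x j                                           ∎
  where
  open ≡-Reasoning
  plus-minus : ∀ (a r : ℤ) → (a ℤ.+ r) ℤ.- r ≡ a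
  plus-minus = solve-∀

-- ι(x) = −x − 2ρ, the twisted action of −1.
ι : ∀ {n} → Vecℤ (suc n) → Vecℤ (suc n)
ι {n} x i = - x i ℤ.- (ρ n i ℤ.+ ρ n i)

-- ι commutes with every twisted action, since ι(x) + ρ = −(x + ρ).
dot-ι : ∀ {n} (w : SPerm (suc n)) (x : Vecℤ (suc n)) → dot w (ι x) ≗ ι (dot w x)
dot-ι {n} w x j = begin
  act w (ι x +ᵥ ρ n) j ℤ.- ρ n j                ≡⟨ cong (ℤ._- ρ n j) (act-cong w shifted j) ⟩
  act w (negᵥ (x +ᵥ ρ n)) j ℤ.- ρ n j           ≡⟨ cong (ℤ._- ρ n j) (act-neg w (x +ᵥ ρ n) j) ⟩
  - act w (x +ᵥ ρ n) j ℤ.- ρ n j                ≡⟨ regroup (act w (x +ᵥ ρ n) j) (ρ n j) ⟩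
  ι (dot w x) j                                 ∎
  where
  open ≡-Reasoning
  shift : ∀ (a r : ℤ) → (- a ℤ.- (r ℤ.+ r)) ℤ.+ r ≡ - (a ℤ.+ r)
  shift = solve-∀
  shifted : ι x +ᵥ ρ n ≗ negᵥ (x +ᵥ ρ n)
  shifted i = shift (x i) (ρ n i)
  regroup : ∀ (a r : ℤ) → - a ℤ.- r ≡ - (a ℤ.- r) ℤ.- (r ℤ.+ r)
  regroup = solve-∀

-- ρ_j = n − j (truncated) vanishes for j ≥ n.
ρ-beyond : ∀ n (j : Fin (suc n)) → (toℕ j ℕ.<ᵇ n) ≡ false → ρ n j ≡ + 0
ρ-beyond n j j≮n = cong +_ (ℕP.m≤n⇒m∸n≡0 {n} {toℕ j} (ℕP.≮⇒≥ (λ j<n → subst T j≮n (ℕP.<⇒<ᵇ j<n))))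

ρ-at : ∀ n (j : Fin (suc n)) → (toℕ j ℕ.≡ᵇ n) ≡ true → ρ n j ≡ + 0
ρ-at n j j≡n = cong +_ (trans (cong (n ℕ.∸_) (ℕP.≡ᵇ⇒≡ (toℕ j) n (subst T (sym j≡n) tt))) (ℕP.n∸n≡0 n))

ρ₀ : ∀ n → ρ n zero ℤ.+ ρ n zero ≡ + (2 ℕ.* n)
ρ₀ n = cong +_ (cong (n ℕ.+_) (sym (ℕP.+-identityʳ n)))

-- w_G ρ = −ρ, hence w_G · (−w_G x) = ι(x): the twisted action of w_G on
-- the contragredient weight.
dot-wG-dual : ∀ n (x : Vecℤ (suc n)) → dot (wG n) (negᵥ (act (wG n) x)) ≗ ι x
dot-wG-dual n x j with toℕ j ℕ.<ᵇ n in j<n?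
... | true  = flip-sign (x j) (ρ n j)
  where
  flip-sign : ∀ (a r : ℤ) → - 1ℤ ℤ.* (- (- 1ℤ ℤ.* a) ℤ.+ r) ℤ.- r ≡ - a ℤ.- (r ℤ.+ r)
  flip-sign = solve-∀
... | false = keep-sign (x j) (ρ n j) (ρ-beyond n j j<n?)
  where
  keep-sign₀ : ∀ (a : ℤ) → 1ℤ ℤ.* (- (1ℤ ℤ.* a) ℤ.+ + 0) ℤ.- + 0 ≡ - a ℤ.- (+ 0 ℤ.+ + 0)
  keep-sign₀ = solve-∀
  keep-sign : ∀ (a r : ℤ) → r ≡ + 0 → 1ℤ ℤ.* (- (1ℤ ℤ.* a) ℤ.+ r) ℤ.- r ≡ - a ℤ.- (r ℤ.+ r)
  keep-sign a .(+ 0) refl = keep-sign₀ a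

dot-wP : ∀ n (c : ℤ) (μ : Fin n → ℤ) → dot (wP n) (c e₀+ μ) ≗ ((- c ℤ.- + (2 ℕ.* n)) e₀+ κ μ)
dot-wP n c μ zero rewrite sym (ρ₀ n) = reflect-e₀ c (+ n)
  where
  reflect-e₀ : ∀ (c r : ℤ) → - 1ℤ ℤ.* (c ℤ.+ r) ℤ.- r ≡ - c ℤ.- (r ℤ.+ r)
  reflect-e₀ = solve-∀
dot-wP n c μ (suc i) with suc (toℕ i) ℕ.≡ᵇ n in last?
... | true rewrite ρ-at n (suc i) last? = reflect-last (μ i)
  where
  reflect-last : ∀ (a : ℤ) → - 1ℤ ℤ.* (a ℤ.+ + 0) ℤ.- + 0 ≡ - a
  reflect-last = solve-∀
... | false = fixed (μ i) (ρ n (suc i))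
  where
  fixed : ∀ (a r : ℤ) → 1ℤ ℤ.* (a ℤ.+ r) ℤ.- r ≡ a
  fixed = solve-∀

dot-wM-ι : ∀ n (c : ℤ) (μ : Fin n → ℤ) → dot (wM n) (ι (c e₀+ μ)) ≗ ((- c ℤ.- + (2 ℕ.* n)) e₀+ μ)
dot-wM-ι n c μ zero rewrite sym (ρ₀ n) = fixed-e₀ c (+ n)
  where
  fixed-e₀ : ∀ (c r : ℤ) → 1ℤ ℤ.* ((- c ℤ.- (r ℤ.+ r)) ℤ.+ r) ℤ.- r ≡ - c ℤ.- (r ℤ.+ r)
  fixed-e₀ = solve-∀
dot-wM-ι n c μ (suc i) = reflect (μ i) (ρ n (suc i))
  where
  reflect : ∀ (a r : ℤ) → - 1ℤ ℤ.* ((- a ℤ.- (r ℤ.+ r)) ℤ.+ r) ℤ.- r ≡ a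
  reflect = solve-∀

e₀+-cong : ∀ {n} {c c′ : ℤ} (μ : Fin n → ℤ) → c ≡ c′ → (c e₀+ μ) ≗ (c′ e₀+ μ)
e₀+-cong μ refl j = refl

double-reflection : ∀ (c t : ℤ) → - (- c ℤ.- t) ℤ.- t ≡ c
double-reflection = solve-∀

dual-orbit : ∀ n (w : SPerm (suc n)) (v : Vecℤ (suc n)) →
             dot (w ∘ʷ wG n) (negᵥ (act (wG n) (dot (invʷ w) v))) ≗ ι v
dual-orbit n w v j = begin
  dot (w ∘ʷ wG n) λ∨ j                          ≡⟨ dot-∘ w (wG n) λ∨ j ⟩
  dot w (dot (wG n) λ∨) j                       ≡⟨ dot-cong w (dot-wG-dual n λ′) j ⟩
  dot w (ι λ′) j                                ≡⟨ dot-ι w λ′ j ⟩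
  ι (dot w λ′) j                                ≡⟨ cong (λ a → - a ℤ.- (ρ n j ℤ.+ ρ n j)) (dot-invʳ w v j) ⟩
  ι v j                                         ∎
  where
  open ≡-Reasoning
  λ′ : Vecℤ (suc n)
  λ′ = dot (invʷ w) v
  λ∨ : Vecℤ (suc n)
  λ∨ = negᵥ (act (wG n) λ′)

proposition5p5 :
    (k : ℕ) (n : ℕ) → 2 ∣ n → 1 ℕ.≤ n →
    (d : ℤ) (μ : Fin (suc k) → Fin n → ℤ) →
    ((τ : Fin (suc k)) → DominantM n (μ τ)) →
    1ℤ ≤ μmin μ →
    1ℤ ℤ.- μmin μ ≤ - (+ n ℤ.+ d) → - (+ n ℤ.+ d) ≤ μmin μ ℤ.- 1ℤ →
    (w : Fin (suc k) → SPerm (suc n)) →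
    ((τ : Fin (suc k)) → InWP0 n (w τ)) →
    ((τ : Fin (suc k)) → Balanced n (w τ)) →
    ((τ : Fin (suc k)) → DominantG n (dot (invʷ (w τ)) (d e₀+ μ τ))) →
    (τ : Fin (suc k)) (j : Fin (suc n)) →
      (dot (wP n ∘ʷ w τ) (dot (invʷ (w τ)) (d e₀+ μ τ)) j
         ≡ ((- d ℤ.- + (2 ℕ.* n)) e₀+ κ (μ τ)) j)
    × (dot (wM n ∘ʷ (w τ ∘ʷ wG n)) (negᵥ (act (wG n) (dot (invʷ (w τ)) (d e₀+ μ τ)))) j
         ≡ ((- d ℤ.- + (2 ℕ.* n)) e₀+ μ τ) j)
    × (dot (wP n ∘ʷ (wM n ∘ʷ (w τ ∘ʷ wG n))) (negᵥ (act (wG n) (dot (invʷ (w τ)) (d e₀+ μ τ)))) j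
         ≡ (d e₀+ κ (μ τ)) j)
proposition5p5 k n _ _ d μ _ _ _ _ w _ _ _ τ j = part1 j , part2 j , part3
  where
  open ≡-Reasoning
  v : Vecℤ (suc n)
  v = d e₀+ μ τ
  λ∨ : Vecℤ (suc n)
  λ∨ = negᵥ (act (wG n) (dot (invʷ (w τ)) v))
  part1 : dot (wP n ∘ʷ w τ) (dot (invʷ (w τ)) v) ≗ ((- d ℤ.- + (2 ℕ.* n)) e₀+ κ (μ τ))
  part1 i = trans (dot-∘ (wP n) (w τ) (dot (invʷ (w τ)) v) i)
                  (trans (dot-cong (wP n) (dot-invʳ (w τ) v) i) (dot-wP n d (μ τ) i))
  part2 : dot (wM n ∘ʷ (w τ ∘ʷ wG n)) λ∨ ≗ ((- d ℤ.- + (2 ℕ.* n)) e₀+ μ τ)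
  part2 i = trans (dot-∘ (wM n) (w τ ∘ʷ wG n) λ∨ i)
                  (trans (dot-cong (wM n) (dual-orbit n (w τ) v) i) (dot-wM-ι n d (μ τ) i))
  part3 : dot (wP n ∘ʷ (wM n ∘ʷ (w τ ∘ʷ wG n))) λ∨ j ≡ (d e₀+ κ (μ τ)) j
  part3 = begin
    dot (wP n ∘ʷ (wM n ∘ʷ (w τ ∘ʷ wG n))) λ∨ j            ≡⟨ dot-∘ (wP n) (wM n ∘ʷ (w τ ∘ʷ wG n)) λ∨ j ⟩
    dot (wP n) (dot (wM n ∘ʷ (w τ ∘ʷ wG n)) λ∨) j          ≡⟨ dot-cong (wP n) part2 j ⟩
    dot (wP n) ((- d ℤ.- + (2 ℕ.* n)) e₀+ μ τ) j           ≡⟨ dot-wP n (- d ℤ.- + (2 ℕ.* n)) (μ τ) j ⟩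
    ((- (- d ℤ.- + (2 ℕ.* n)) ℤ.- + (2 ℕ.* n)) e₀+ κ (μ τ)) j
                                                           ≡⟨ e₀+-cong (κ (μ τ)) (double-reflection d (+ (2 ℕ.* n))) j ⟩
    (d e₀+ κ (μ τ)) j                                      ∎
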